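{- Every quasivariety $\mathbb R$ of MV-algebras is categorically equivalent to the quasivariety $\mathbb{IR}$ generated by its interval algebras $\{\mathcal I(A)\mid A\in\mathbb R\}$, the equivalence being given by the interval functor $A\mapsto\mathcal I(A)$, $h\mapsto\mathcal I(h)$ with $\mathcal I(h)([\alpha,\beta])=[h(\alpha),h(\beta)]$.
   Context: MV-algebras $A=(A,0,1,\neg,\oplus,\odot)$ are regarded as bounded partially ordered algebras under their natural order $\leq$ ($\alpha\le\beta$ iff $\neg\alpha\oplus\beta=1$), with $\oplus,\odot$ monotone in both arguments and $\neg$ order-reversing. For an MV-algebra $A$, $\mathcal I(A)$ is the algebra on the set of intervals $[\alpha,\beta]=\{\xi\mid\alpha\leq\xi\leq\beta\}$ ($\alpha\leq\beta$) with constants $0=[0,0]$, $1=[1,1]$, $\iota=[0,1]=A$ and operations $\neg[\alpha,\beta]=[\neg\beta,\neg\alpha]$, $[\alpha,\beta]\oplus[\gamma,\delta]=[\alpha\oplus\gamma,\beta\oplus\delta]$, $[\alpha,\beta]\odot[\gamma,\delta]=[\alpha\odot\gamma,\beta\odot\delta]$, $\Delta[\alpha,\beta]=[\alpha,\alpha]$, $\nabla[\alpha,\beta]=[\beta,\beta]$ (equivalently, pointwise negation, truncated Minkowski sum and pointwise $\odot$). Categories have homomorphisms as morphisms. -}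

module Defs where

open import Level using (Level; _⊔_) renaming (suc to lsuc)
open import Data.Nat using (ℕ)
open import Data.List using (List)
open import Data.List.Relation.Unary.All using (All)
open import Data.Product using (Σ; _×_; _,_; proj₁; proj₂)
open import Relation.Binary using (Rel; IsEquivalence; Setoid)

record MVAlgebra (c : Level) : Set (lsuc c) where
  infix  4 _≈_ _≤_
  infixl 6 _⊕_
  infixl 7 _⊙_
  infix  8 ¬_
  field
    Carrier       : Set c
    _≈_           : Rel Carrier c
    isEquivalence : IsEquivalence _≈_
    𝟘 𝟙           : Carrier
    ¬_            : Carrier → Carrier
    _⊕_ _⊙_       : Carrier → Carrier → Carrier
    ¬-cong        : ∀ {x y} → x ≈ y → ¬ x ≈ ¬ y
    ⊕-cong        : ∀ {x y u v} → x ≈ y → u ≈ v → x ⊕ u ≈ y ⊕ v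
    ⊙-cong        : ∀ {x y u v} → x ≈ y → u ≈ v → x ⊙ u ≈ y ⊙ v
    ⊕-assoc       : ∀ x y z → (x ⊕ y) ⊕ z ≈ x ⊕ (y ⊕ z)
    ⊕-comm        : ∀ x y → x ⊕ y ≈ y ⊕ x
    ⊕-identityʳ   : ∀ x → x ⊕ 𝟘 ≈ x
    ¬-involutive  : ∀ x → ¬ ¬ x ≈ x
    ⊕-absorb      : ∀ x → x ⊕ ¬ 𝟘 ≈ ¬ 𝟘
    łukasiewicz   : ∀ x y → ¬ (¬ x ⊕ y) ⊕ y ≈ ¬ (¬ y ⊕ x) ⊕ x
    𝟙-def         : 𝟙 ≈ ¬ 𝟘
    ⊙-def         : ∀ x y → x ⊙ y ≈ ¬ (¬ x ⊕ ¬ y)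

  _≤_ : Rel Carrier c
  x ≤ y = ¬ x ⊕ y ≈ 𝟙

  setoid : Setoid c c
  setoid = record { Carrier = Carrier ; _≈_ = _≈_ ; isEquivalence = isEquivalence }

  open IsEquivalence isEquivalence public
    renaming (refl to ≈-refl; sym to ≈-sym; trans to ≈-trans)

module MVProperties {c : Level} (A : MVAlgebra c) where
  open MVAlgebra A
  open import Relation.Binary.Reasoning.Setoid setoid

  ⊕-𝟙 : ∀ x → x ⊕ 𝟙 ≈ 𝟙
  ⊕-𝟙 x = begin
    x ⊕ 𝟙   ≈⟨ ⊕-cong ≈-refl 𝟙-def ⟩
    x ⊕ ¬ 𝟘 ≈⟨ ⊕-absorb x ⟩
    ¬ 𝟘     ≈⟨ ≈-sym 𝟙-def ⟩
    𝟙       ∎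

  𝟙-⊕ : ∀ x → 𝟙 ⊕ x ≈ 𝟙
  𝟙-⊕ x = ≈-trans (⊕-comm 𝟙 x) (⊕-𝟙 x)

  ¬𝟙 : ¬ 𝟙 ≈ 𝟘
  ¬𝟙 = ≈-trans (¬-cong 𝟙-def) (¬-involutive 𝟘)

  𝟘-⊕ : ∀ x → 𝟘 ⊕ x ≈ x
  𝟘-⊕ x = ≈-trans (⊕-comm 𝟘 x) (⊕-identityʳ x)

  compl : ∀ a → ¬ a ⊕ a ≈ 𝟙
  compl a = begin
    ¬ a ⊕ a               ≈⟨ ⊕-cong (¬-cong (≈-sym (≈-trans (⊕-cong ¬𝟙 ≈-refl) (𝟘-⊕ a)))) ≈-refl ⟩
    ¬ (¬ 𝟙 ⊕ a) ⊕ a       ≈⟨ ≈-sym (łukasiewicz a 𝟙) ⟩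
    ¬ (¬ a ⊕ 𝟙) ⊕ 𝟙       ≈⟨ ⊕-𝟙 _ ⟩
    𝟙                     ∎

  ≤-refl : ∀ a → a ≤ a
  ≤-refl = compl

  ≤-ext : ∀ {a b} z → b ≈ a ⊕ z → a ≤ b
  ≤-ext {a} {b} z eq = begin
    ¬ a ⊕ b         ≈⟨ ⊕-cong ≈-refl eq ⟩
    ¬ a ⊕ (a ⊕ z)   ≈⟨ ≈-sym (⊕-assoc _ _ _) ⟩
    (¬ a ⊕ a) ⊕ z   ≈⟨ ⊕-cong (compl a) ≈-refl ⟩
    𝟙 ⊕ z           ≈⟨ 𝟙-⊕ z ⟩
    𝟙               ∎

  ≤-decomp : ∀ {a b} → a ≤ b → b ≈ a ⊕ ¬ (¬ b ⊕ a)
  ≤-decomp {a} {b} a≤b = begin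
    b                       ≈⟨ ≈-sym (𝟘-⊕ b) ⟩
    𝟘 ⊕ b                   ≈⟨ ⊕-cong (≈-sym (≈-trans (¬-cong a≤b) ¬𝟙)) ≈-refl ⟩
    ¬ (¬ a ⊕ b) ⊕ b         ≈⟨ łukasiewicz a b ⟩
    ¬ (¬ b ⊕ a) ⊕ a         ≈⟨ ⊕-comm _ _ ⟩
    a ⊕ ¬ (¬ b ⊕ a)         ∎

  ≤-resp : ∀ {a a' b b'} → a ≈ a' → b ≈ b' → a ≤ b → a' ≤ b'
  ≤-resp p q a≤b = ≈-trans (⊕-cong (¬-cong (≈-sym p)) (≈-sym q)) a≤b

  ¬-anti : ∀ {a b} → a ≤ b → ¬ b ≤ ¬ a
  ¬-anti {a} {b} a≤b = begin
    ¬ ¬ b ⊕ ¬ a   ≈⟨ ⊕-cong (¬-involutive b) ≈-refl ⟩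
    b ⊕ ¬ a       ≈⟨ ⊕-comm _ _ ⟩
    ¬ a ⊕ b       ≈⟨ a≤b ⟩
    𝟙             ∎

  ⊕-mono : ∀ {a b u v} → a ≤ b → u ≤ v → a ⊕ u ≤ b ⊕ v
  ⊕-mono {a} {b} {u} {v} a≤b u≤v = ≤-ext (x ⊕ y) (begin
    b ⊕ v                 ≈⟨ ⊕-cong (≤-decomp a≤b) (≤-decomp u≤v) ⟩
    (a ⊕ x) ⊕ (u ⊕ y)     ≈⟨ ⊕-assoc _ _ _ ⟩
    a ⊕ (x ⊕ (u ⊕ y))     ≈⟨ ⊕-cong ≈-refl (≈-sym (⊕-assoc _ _ _)) ⟩
    a ⊕ ((x ⊕ u) ⊕ y)     ≈⟨ ⊕-cong ≈-refl (⊕-cong (⊕-comm _ _) ≈-refl) ⟩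
    a ⊕ ((u ⊕ x) ⊕ y)     ≈⟨ ⊕-cong ≈-refl (⊕-assoc _ _ _) ⟩
    a ⊕ (u ⊕ (x ⊕ y))     ≈⟨ ≈-sym (⊕-assoc _ _ _) ⟩
    (a ⊕ u) ⊕ (x ⊕ y)     ∎)
    where
      x = ¬ (¬ b ⊕ a)
      y = ¬ (¬ v ⊕ u)

  ⊙-mono : ∀ {a b u v} → a ≤ b → u ≤ v → a ⊙ u ≤ b ⊙ v
  ⊙-mono a≤b u≤v =
    ≤-resp (≈-sym (⊙-def _ _)) (≈-sym (⊙-def _ _))
      (¬-anti (⊕-mono (¬-anti a≤b) (¬-anti u≤v)))

  𝟘≤𝟙 : 𝟘 ≤ 𝟙
  𝟘≤𝟙 = ≤-ext 𝟙 (≈-sym (𝟘-⊕ 𝟙))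

record MVHom {c : Level} (A B : MVAlgebra c) : Set c where
  private
    module A = MVAlgebra A
    module B = MVAlgebra B
  field
    fun      : A.Carrier → B.Carrier
    fun-cong : ∀ {x y} → x A.≈ y → fun x B.≈ fun y
    𝟘-hom    : fun A.𝟘 B.≈ B.𝟘
    𝟙-hom    : fun A.𝟙 B.≈ B.𝟙
    ¬-hom    : ∀ x → fun (A.¬ x) B.≈ B.¬ (fun x)
    ⊕-hom    : ∀ x y → fun (x A.⊕ y) B.≈ fun x B.⊕ fun y
    ⊙-hom    : ∀ x y → fun (x A.⊙ y) B.≈ fun x B.⊙ fun y

record IAlgebra (c : Level) : Set (lsuc c) where
  infix  4 _≈_
  infixl 6 _⊕_
  infixl 7 _⊙_
  field
    Carrier       : Set c
    _≈_           : Rel Carrier c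
    isEquivalence : IsEquivalence _≈_
    𝟘 𝟙 ι         : Carrier
    ¬_ Δ ∇        : Carrier → Carrier
    _⊕_ _⊙_       : Carrier → Carrier → Carrier
    ¬-cong        : ∀ {x y} → x ≈ y → ¬ x ≈ ¬ y
    Δ-cong        : ∀ {x y} → x ≈ y → Δ x ≈ Δ y
    ∇-cong        : ∀ {x y} → x ≈ y → ∇ x ≈ ∇ y
    ⊕-cong        : ∀ {x y u v} → x ≈ y → u ≈ v → x ⊕ u ≈ y ⊕ v
    ⊙-cong        : ∀ {x y u v} → x ≈ y → u ≈ v → x ⊙ u ≈ y ⊙ v

record IHom {c : Level} (C D : IAlgebra c) : Set c where
  private
    module C = IAlgebra C
    module D = IAlgebra D
  field
    fun      : C.Carrier → D.Carrier
    fun-cong : ∀ {x y} → x C.≈ y → fun x D.≈ fun y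
    𝟘-hom    : fun C.𝟘 D.≈ D.𝟘
    𝟙-hom    : fun C.𝟙 D.≈ D.𝟙
    ι-hom    : fun C.ι D.≈ D.ι
    ¬-hom    : ∀ x → fun (C.¬ x) D.≈ D.¬ (fun x)
    Δ-hom    : ∀ x → fun (C.Δ x) D.≈ D.Δ (fun x)
    ∇-hom    : ∀ x → fun (C.∇ x) D.≈ D.∇ (fun x)
    ⊕-hom    : ∀ x y → fun (x C.⊕ y) D.≈ fun x D.⊕ fun y
    ⊙-hom    : ∀ x y → fun (x C.⊙ y) D.≈ fun x D.⊙ fun y

record IIso {c : Level} (C D : IAlgebra c) : Set c where
  private
    module C = IAlgebra C
    module D = IAlgebra D
  field
    to       : IHom C D
    from     : IHom D C
    from∘to  : ∀ x → IHom.fun from (IHom.fun to x) C.≈ x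
    to∘from  : ∀ y → IHom.fun to (IHom.fun from y) D.≈ y

record Interval {c : Level} (A : MVAlgebra c) : Set c where
  constructor ⟦_,_⟧⟨_⟩
  open MVAlgebra A
  field
    lo hi : Carrier
    lo≤hi : lo ≤ hi

module _ {c : Level} (A : MVAlgebra c) where
  open MVAlgebra A
  open MVProperties A
  open Interval

  _≈ᵢ_ : Rel (Interval A) c
  x ≈ᵢ y = (lo x ≈ lo y) × (hi x ≈ hi y)

  𝓘 : IAlgebra c
  𝓘 = record
    { Carrier = Interval A
    ; _≈_ = _≈ᵢ_
    ; isEquivalence = record
        { refl = ≈-refl , ≈-refl
        ; sym = λ p → ≈-sym (proj₁ p) , ≈-sym (proj₂ p)
        ; trans = λ p q → ≈-trans (proj₁ p) (proj₁ q) , ≈-trans (proj₂ p) (proj₂ q) }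
    ; 𝟘 = ⟦ 𝟘 , 𝟘 ⟧⟨ ≤-refl 𝟘 ⟩
    ; 𝟙 = ⟦ 𝟙 , 𝟙 ⟧⟨ ≤-refl 𝟙 ⟩
    ; ι = ⟦ 𝟘 , 𝟙 ⟧⟨ 𝟘≤𝟙 ⟩
    ; ¬_ = λ x → ⟦ ¬ hi x , ¬ lo x ⟧⟨ ¬-anti (lo≤hi x) ⟩
    ; Δ = λ x → ⟦ lo x , lo x ⟧⟨ ≤-refl (lo x) ⟩
    ; ∇ = λ x → ⟦ hi x , hi x ⟧⟨ ≤-refl (hi x) ⟩
    ; _⊕_ = λ x y → ⟦ lo x ⊕ lo y , hi x ⊕ hi y ⟧⟨ ⊕-mono (lo≤hi x) (lo≤hi y) ⟩
    ; _⊙_ = λ x y → ⟦ lo x ⊙ lo y , hi x ⊙ hi y ⟧⟨ ⊙-mono (lo≤hi x) (lo≤hi y) ⟩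
    ; ¬-cong = λ p → ¬-cong (proj₂ p) , ¬-cong (proj₁ p)
    ; Δ-cong = λ p → proj₁ p , proj₁ p
    ; ∇-cong = λ p → proj₂ p , proj₂ p
    ; ⊕-cong = λ p q → ⊕-cong (proj₁ p) (proj₁ q) , ⊕-cong (proj₂ p) (proj₂ q)
    ; ⊙-cong = λ p q → ⊙-cong (proj₁ p) (proj₁ q) , ⊙-cong (proj₂ p) (proj₂ q)
    }

module _ {c : Level} {A B : MVAlgebra c} (h : MVHom A B) where
  private
    module A = MVAlgebra A
    module B = MVAlgebra B
  open MVHom h
  open Interval

  hom-mono : ∀ {x y} → x A.≤ y → fun x B.≤ fun y
  hom-mono {x} {y} p =
    B.≈-trans (B.≈-sym (B.≈-trans (⊕-hom _ _) (B.⊕-cong (¬-hom x) B.≈-refl)))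
      (B.≈-trans (fun-cong p) 𝟙-hom)

  𝓘map : Interval A → Interval B
  𝓘map x = ⟦ fun (lo x) , fun (hi x) ⟧⟨ hom-mono (lo≤hi x) ⟩

  𝓘hom : IHom (𝓘 A) (𝓘 B)
  𝓘hom = record
    { fun = 𝓘map
    ; fun-cong = λ p → fun-cong (proj₁ p) , fun-cong (proj₂ p)
    ; 𝟘-hom = 𝟘-hom , 𝟘-hom
    ; 𝟙-hom = 𝟙-hom , 𝟙-hom
    ; ι-hom = 𝟘-hom , 𝟙-hom
    ; ¬-hom = λ x → ¬-hom (hi x) , ¬-hom (lo x)
    ; Δ-hom = λ x → B.≈-refl , B.≈-refl
    ; ∇-hom = λ x → B.≈-refl , B.≈-refl
    ; ⊕-hom = λ x y → ⊕-hom (lo x) (lo y) , ⊕-hom (hi x) (hi y)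
    ; ⊙-hom = λ x y → ⊙-hom (lo x) (lo y) , ⊙-hom (hi x) (hi y)
    }

data MVTerm : Set where
  var       : ℕ → MVTerm
  𝟘ₜ 𝟙ₜ     : MVTerm
  ¬ₜ        : MVTerm → MVTerm
  _⊕ₜ_ _⊙ₜ_ : MVTerm → MVTerm → MVTerm

data ITerm : Set where
  var       : ℕ → ITerm
  𝟘ₜ 𝟙ₜ ιₜ  : ITerm
  ¬ₜ Δₜ ∇ₜ  : ITerm → ITerm
  _⊕ₜ_ _⊙ₜ_ : ITerm → ITerm → ITerm

record Equation (T : Set) : Set where
  constructor _≐_
  field
    lhs rhs : T

record QuasiIdentity (T : Set) : Set where
  constructor _⟹_
  field
    premises   : List (Equation T)
    conclusion : Equation T

module _ {c : Level} (A : MVAlgebra c) where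
  open MVAlgebra A

  evalMV : MVTerm → (ℕ → Carrier) → Carrier
  evalMV (var n) ρ = ρ n
  evalMV 𝟘ₜ ρ = 𝟘
  evalMV 𝟙ₜ ρ = 𝟙
  evalMV (¬ₜ t) ρ = ¬ evalMV t ρ
  evalMV (s ⊕ₜ t) ρ = evalMV s ρ ⊕ evalMV t ρ
  evalMV (s ⊙ₜ t) ρ = evalMV s ρ ⊙ evalMV t ρ

  holdsMV : (ℕ → Carrier) → Equation MVTerm → Set c
  holdsMV ρ (s ≐ t) = evalMV s ρ ≈ evalMV t ρ

  _⊨MV_ : QuasiIdentity MVTerm → Set c
  _⊨MV_ (ps ⟹ e) = ∀ (ρ : ℕ → Carrier) → All (holdsMV ρ) ps → holdsMV ρ e

module _ {c : Level} (C : IAlgebra c) where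
  open IAlgebra C

  evalI : ITerm → (ℕ → Carrier) → Carrier
  evalI (var n) ρ = ρ n
  evalI 𝟘ₜ ρ = 𝟘
  evalI 𝟙ₜ ρ = 𝟙
  evalI ιₜ ρ = ι
  evalI (¬ₜ t) ρ = ¬ evalI t ρ
  evalI (Δₜ t) ρ = Δ (evalI t ρ)
  evalI (∇ₜ t) ρ = ∇ (evalI t ρ)
  evalI (s ⊕ₜ t) ρ = evalI s ρ ⊕ evalI t ρ
  evalI (s ⊙ₜ t) ρ = evalI s ρ ⊙ evalI t ρ

  holdsI : (ℕ → Carrier) → Equation ITerm → Set c
  holdsI ρ (s ≐ t) = evalI s ρ ≈ evalI t ρ

  _⊨I_ : QuasiIdentity ITerm → Set c
  _⊨I_ (ps ⟹ e) = ∀ (ρ : ℕ → Carrier) → All (holdsI ρ) ps → holdsI ρ e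

-- The quasivariety ℝ of MV-algebras axiomatised (relative to the MV-algebra
-- axioms, which are built into MVAlgebra) by a set Σq of quasi-identities.
ModMV : ∀ {c ℓ} → (QuasiIdentity MVTerm → Set ℓ) → MVAlgebra c → Set (c ⊔ ℓ)
ModMV Σq A = ∀ q → Σq q → A ⊨MV q

-- 𝕀ℝ : the quasivariety generated by the interval algebras {𝓘(A) | A ∈ ℝ},
-- i.e. the class of all algebras (of the interval signature) satisfying
-- every quasi-identity valid in all 𝓘(A), A ∈ ℝ (the smallest class defined
-- by quasi-identities containing them).
𝕀 : ∀ {c ℓ} → (MVAlgebra c → Set ℓ) → IAlgebra c → Set (lsuc c ⊔ ℓ)
𝕀 {c} R C = ∀ q → (∀ (A : MVAlgebra c) → R A → 𝓘 A ⊨I q) → C ⊨I q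

{-# OPTIONS --safe #-}
-- The interval functor is faithful and full because a homomorphism of interval algebras
-- commutes with Δ and ∇, so it is determined by, and induced from, its values on the
-- degenerate intervals [a, a].
--
-- For essential surjectivity, let C satisfy every quasi-identity valid in the interval
-- algebras 𝓘(A), A ∈ ℝ. Translating an MV-term by reading ¬ as ¬Δ, and an equation
-- s = t as Δs = Δt, gives a quasi-identity that holds in 𝓘(A) exactly when the original
-- holds in A. Hence Δ[C], with negation ¬Δ, is an MV-algebra lying in ℝ. Finally
-- x ↦ [Δx, ∇x] is an isomorphism C ≅ 𝓘(Δ[C]) with inverse [a, b] ↦ Δa ⊕ ι ⊙ (Δb ⊙ ¬Δa),
-- since in every interval algebra [a, b] = [a, a] ⊕ [0, 1] ⊙ [b ⊙ ¬a, b ⊙ ¬a] when a ≤ b.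
module Submission where

open import Defs
open import Level using (Level)
open import Function using (_∘_; const)
open import Data.Nat using (ℕ; zero; suc)
open import Data.List using ([]; _∷_; map)
open import Data.List.Relation.Unary.All as All using ([]; _∷_)
open import Data.List.Relation.Unary.All.Properties using (map⁺; map⁻)
open import Data.Product using (Σ; _×_; _,_; proj₁; proj₂)
open import Relation.Binary.Structures using (IsEquivalence)
open import Relation.Binary.PropositionalEquality as ≡ using (_≡_; refl; cong; cong₂)

open Interval

module MVLemmas {c : Level} (A : MVAlgebra c) where
  open MVAlgebra A
  open MVProperties A
  open import Relation.Binary.Reasoning.Setoid setoid

  ⊙-zeroˡ : ∀ y → 𝟘 ⊙ y ≈ 𝟘
  ⊙-zeroˡ y = begin
    𝟘 ⊙ y          ≈⟨ ⊙-def 𝟘 y ⟩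
    ¬ (¬ 𝟘 ⊕ ¬ y)  ≈⟨ ¬-cong (≈-trans (⊕-comm _ _) (⊕-absorb _)) ⟩
    ¬ ¬ 𝟘          ≈⟨ ¬-involutive 𝟘 ⟩
    𝟘              ∎

  ⊙-identityˡ : ∀ y → 𝟙 ⊙ y ≈ y
  ⊙-identityˡ y = begin
    𝟙 ⊙ y          ≈⟨ ⊙-def 𝟙 y ⟩
    ¬ (¬ 𝟙 ⊕ ¬ y)  ≈⟨ ¬-cong (≈-trans (⊕-cong ¬𝟙 ≈-refl) (𝟘-⊕ _)) ⟩
    ¬ ¬ y          ≈⟨ ¬-involutive y ⟩
    y              ∎

  x⊕𝟘⊙y≈x : ∀ x y → x ⊕ 𝟘 ⊙ y ≈ x
  x⊕𝟘⊙y≈x x y = ≈-trans (⊕-cong ≈-refl (⊙-zeroˡ y)) (⊕-identityʳ x)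

  x≤y⇒x⊕𝟙⊙[y⊙¬x]≈y : ∀ {x y} → x ≤ y → x ⊕ 𝟙 ⊙ (y ⊙ ¬ x) ≈ y
  x≤y⇒x⊕𝟙⊙[y⊙¬x]≈y {x} {y} x≤y = begin
    x ⊕ 𝟙 ⊙ (y ⊙ ¬ x)    ≈⟨ ⊕-cong ≈-refl (⊙-identityˡ _) ⟩
    x ⊕ y ⊙ ¬ x          ≈⟨ ⊕-cong ≈-refl (⊙-def y (¬ x)) ⟩
    x ⊕ ¬ (¬ y ⊕ ¬ ¬ x)  ≈⟨ ⊕-cong ≈-refl (¬-cong (⊕-cong ≈-refl (¬-involutive x))) ⟩
    x ⊕ ¬ (¬ y ⊕ x)      ≈⟨ ≈-sym (≤-decomp x≤y) ⟩
    y                    ∎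

point : ∀ {c} (A : MVAlgebra c) → MVAlgebra.Carrier A → Interval A
point A a = ⟦ a , a ⟧⟨ MVProperties.≤-refl A a ⟩

𝓘-∈-𝕀 : ∀ {c ℓ} {R : MVAlgebra c → Set ℓ} {A : MVAlgebra c} → R A → 𝕀 R (𝓘 A)
𝓘-∈-𝕀 {A = A} A∈R q valid = valid A A∈R

𝓘map-injective : ∀ {c} {A B : MVAlgebra c} (h g : MVHom A B) →
  (∀ x → IAlgebra._≈_ (𝓘 B) (𝓘map h x) (𝓘map g x)) →
  ∀ a → MVAlgebra._≈_ B (MVHom.fun h a) (MVHom.fun g a)
𝓘map-injective {A = A} h g 𝓘h≈𝓘g a = proj₁ (𝓘h≈𝓘g (point A a))

module _ {c : Level} {A B : MVAlgebra c} (f : IHom (𝓘 A) (𝓘 B)) where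
  open IHom f

  private
    module A = MVAlgebra A
    module B = MVAlgebra B

    lo-fun-cong : ∀ {x y} → IAlgebra._≈_ (𝓘 A) x y → lo (fun x) B.≈ lo (fun y)
    lo-fun-cong = proj₁ ∘ fun-cong

    hi≈lo-at-point : ∀ a → hi (fun (point A a)) B.≈ lo (fun (point A a))
    hi≈lo-at-point a = proj₂ (Δ-hom (point A a))

  -- point (¬ a) and ¬ point a differ only in their order proofs, hence the fun-cong steps.
  onPoints : MVHom A B
  onPoints = record
    { fun      = λ a → lo (fun (point A a))
    ; fun-cong = λ a≈b → lo-fun-cong (a≈b , a≈b)
    ; 𝟘-hom    = proj₁ 𝟘-hom
    ; 𝟙-hom    = proj₁ 𝟙-hom
    ; ¬-hom    = λ a → B.≈-trans (lo-fun-cong (A.≈-refl , A.≈-refl))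
                         (B.≈-trans (proj₁ (¬-hom (point A a))) (B.¬-cong (hi≈lo-at-point a)))
    ; ⊕-hom    = λ a b → B.≈-trans (lo-fun-cong (A.≈-refl , A.≈-refl))
                           (proj₁ (⊕-hom (point A a) (point A b)))
    ; ⊙-hom    = λ a b → B.≈-trans (lo-fun-cong (A.≈-refl , A.≈-refl))
                           (proj₁ (⊙-hom (point A a) (point A b)))
    }

  onPoints-extends : ∀ x → IAlgebra._≈_ (𝓘 B) (fun x) (𝓘map onPoints x)
  onPoints-extends x = B.≈-sym (proj₁ (Δ-hom x))
                     , B.≈-trans (B.≈-sym (proj₂ (∇-hom x))) (hi≈lo-at-point (hi x))

module _ {c : Level} {C D : IAlgebra c} where
  private
    module C = IAlgebra C
    module D = IAlgebra D
    module Cₑ = IsEquivalence C.isEquivalence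
    module Dₑ = IsEquivalence D.isEquivalence

  mkIIso : (to : IHom C D) (from : D.Carrier → C.Carrier) →
    (∀ {x y} → x D.≈ y → from x C.≈ from y) →
    (∀ x → from (IHom.fun to x) C.≈ x) →
    (∀ y → IHom.fun to (from y) D.≈ y) →
    IIso C D
  mkIIso to from from-cong from∘to to∘from = record
    { to      = to
    ; from    = record
      { fun      = from
      ; fun-cong = from-cong
      ; 𝟘-hom    = from-inverts 𝟘-hom
      ; 𝟙-hom    = from-inverts 𝟙-hom
      ; ι-hom    = from-inverts ι-hom
      ; ¬-hom    = λ y → from-inverts (Dₑ.trans (¬-hom _) (D.¬-cong (to∘from y)))
      ; Δ-hom    = λ y → from-inverts (Dₑ.trans (Δ-hom _) (D.Δ-cong (to∘from y)))
      ; ∇-hom    = λ y → from-inverts (Dₑ.trans (∇-hom _) (D.∇-cong (to∘from y)))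
      ; ⊕-hom    = λ y z → from-inverts (Dₑ.trans (⊕-hom _ _) (D.⊕-cong (to∘from y) (to∘from z)))
      ; ⊙-hom    = λ y z → from-inverts (Dₑ.trans (⊙-hom _ _) (D.⊙-cong (to∘from y) (to∘from z)))
      }
    ; from∘to = from∘to
    ; to∘from = to∘from
    }
    where
      open IHom to
      from-inverts : ∀ {x y} → fun x D.≈ y → from y C.≈ x
      from-inverts to-x≈y = Cₑ.trans (from-cong (Dₑ.sym to-x≈y)) (from∘to _)

toITerm : MVTerm → ITerm
toITerm (var n)  = var n
toITerm 𝟘ₜ       = 𝟘ₜ
toITerm 𝟙ₜ       = 𝟙ₜ
toITerm (¬ₜ t)   = ¬ₜ (Δₜ (toITerm t))
toITerm (s ⊕ₜ t) = toITerm s ⊕ₜ toITerm t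
toITerm (s ⊙ₜ t) = toITerm s ⊙ₜ toITerm t

toIEquation : Equation MVTerm → Equation ITerm
toIEquation (s ≐ t) = Δₜ (toITerm s) ≐ Δₜ (toITerm t)

toIQuasi : QuasiIdentity MVTerm → QuasiIdentity ITerm
toIQuasi (ps ⟹ e) = map toIEquation ps ⟹ toIEquation e

module _ {c : Level} (A : MVAlgebra c) where
  open MVAlgebra A

  lo-evalI-toITerm : ∀ ρ t → lo (evalI (𝓘 A) (toITerm t) ρ) ≡ evalMV A t (lo ∘ ρ)
  lo-evalI-toITerm ρ (var n)  = refl
  lo-evalI-toITerm ρ 𝟘ₜ       = refl
  lo-evalI-toITerm ρ 𝟙ₜ       = refl
  lo-evalI-toITerm ρ (¬ₜ t)   = cong ¬_ (lo-evalI-toITerm ρ t)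
  lo-evalI-toITerm ρ (s ⊕ₜ t) = cong₂ _⊕_ (lo-evalI-toITerm ρ s) (lo-evalI-toITerm ρ t)
  lo-evalI-toITerm ρ (s ⊙ₜ t) = cong₂ _⊙_ (lo-evalI-toITerm ρ s) (lo-evalI-toITerm ρ t)

  𝓘-holds-toIEquation⇒ : ∀ ρ {e} → holdsI (𝓘 A) ρ (toIEquation e) → holdsMV A (lo ∘ ρ) e
  𝓘-holds-toIEquation⇒ ρ {s ≐ t} (s≈t , _) =
    ≡.subst₂ _≈_ (lo-evalI-toITerm ρ s) (lo-evalI-toITerm ρ t) s≈t

  𝓘-holds-toIEquation⇐ : ∀ ρ {e} → holdsMV A (lo ∘ ρ) e → holdsI (𝓘 A) ρ (toIEquation e)
  𝓘-holds-toIEquation⇐ ρ {s ≐ t} s≈t = lo-s≈lo-t , lo-s≈lo-t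
    where
      lo-s≈lo-t =
        ≡.subst₂ _≈_ (≡.sym (lo-evalI-toITerm ρ s)) (≡.sym (lo-evalI-toITerm ρ t)) s≈t

  𝓘-⊨-toIQuasi : ∀ q → A ⊨MV q → 𝓘 A ⊨I toIQuasi q
  𝓘-⊨-toIQuasi (ps ⟹ e) A⊨q ρ premises =
    𝓘-holds-toIEquation⇐ ρ {e}
      (A⊨q (lo ∘ ρ) (All.map (λ {e′} → 𝓘-holds-toIEquation⇒ ρ {e′}) (map⁻ premises)))

assign : ∀ {a} {X : Set a} → X → X → X → ℕ → X
assign x y z zero          = x
assign x y z (suc zero)    = y
assign x y z (suc (suc _)) = z

module ΔReduct {c ℓ : Level} {R : MVAlgebra c → Set ℓ} (C : IAlgebra c) (C∈𝕀R : 𝕀 R C) where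
  open IAlgebra C
  open IsEquivalence isEquivalence renaming (refl to ≈-refl; sym to ≈-sym; trans to ≈-trans)

  C-⊨-toIQuasi : ∀ q → (∀ A → R A → A ⊨MV q) → C ⊨I toIQuasi q
  C-⊨-toIQuasi q valid = C∈𝕀R (toIQuasi q) (λ A A∈R → 𝓘-⊨-toIQuasi A q (valid A A∈R))

  mv-law : ∀ s t → (∀ {A : MVAlgebra c} {ρ} → holdsMV A ρ (s ≐ t)) →
    ∀ ρ → holdsI C ρ (toIEquation (s ≐ t))
  mv-law s t law ρ = C-⊨-toIQuasi ([] ⟹ (s ≐ t)) (λ A _ ρ′ _ → law {A} {ρ′}) ρ []

  interval-law : ∀ s t → (∀ {A : MVAlgebra c} {ρ} → holdsI (𝓘 A) ρ (s ≐ t)) →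
    ∀ ρ → holdsI C ρ (s ≐ t)
  interval-law s t law ρ = C∈𝕀R ([] ⟹ (s ≐ t)) (λ A _ ρ′ _ → law {A} {ρ′}) ρ []

  Δ-law : ∀ s t →
    (∀ {A : MVAlgebra c} {ρ} → MVAlgebra._≈_ A (lo (evalI (𝓘 A) s ρ)) (lo (evalI (𝓘 A) t ρ))) →
    ∀ ρ → Δ (evalI C s ρ) ≈ Δ (evalI C t ρ)
  Δ-law s t law = interval-law (Δₜ s) (Δₜ t) (λ {A} {ρ} → law {A} {ρ} , law {A} {ρ})

  Δ-law-≡ : ∀ s t →
    (∀ {A : MVAlgebra c} {ρ} → lo (evalI (𝓘 A) s ρ) ≡ lo (evalI (𝓘 A) t ρ)) →
    ∀ ρ → Δ (evalI C s ρ) ≈ Δ (evalI C t ρ)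
  Δ-law-≡ s t law = Δ-law s t (λ {A} → MVAlgebra.reflexive A law)

  Δ-⊕ : ∀ x y → Δ (x ⊕ y) ≈ Δ x ⊕ Δ y
  Δ-⊕ x y = interval-law (Δₜ (var 0 ⊕ₜ var 1)) (Δₜ (var 0) ⊕ₜ Δₜ (var 1))
    (λ {A} → MVAlgebra.≈-refl A , MVAlgebra.≈-refl A) (assign x y y)

  Δ-⊙ : ∀ x y → Δ (x ⊙ y) ≈ Δ x ⊙ Δ y
  Δ-⊙ x y = interval-law (Δₜ (var 0 ⊙ₜ var 1)) (Δₜ (var 0) ⊙ₜ Δₜ (var 1))
    (λ {A} → MVAlgebra.≈-refl A , MVAlgebra.≈-refl A) (assign x y y)

  -- Δ[C] presented on the whole carrier of C, elements being compared by their Δ-images.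
  ΔC : MVAlgebra c
  ΔC = record
    { Carrier       = Carrier
    ; _≈_           = λ x y → Δ x ≈ Δ y
    ; isEquivalence = record { refl = ≈-refl ; sym = ≈-sym ; trans = ≈-trans }
    ; 𝟘             = 𝟘
    ; 𝟙             = 𝟙
    ; ¬_            = λ x → ¬ Δ x
    ; _⊕_           = _⊕_
    ; _⊙_           = _⊙_
    ; ¬-cong        = λ x≈y → Δ-cong (¬-cong x≈y)
    ; ⊕-cong        = λ p q → ≈-trans (Δ-⊕ _ _) (≈-trans (⊕-cong p q) (≈-sym (Δ-⊕ _ _)))
    ; ⊙-cong        = λ p q → ≈-trans (Δ-⊙ _ _) (≈-trans (⊙-cong p q) (≈-sym (Δ-⊙ _ _)))
    ; ⊕-assoc       = λ x y z → mv-law ((var 0 ⊕ₜ var 1) ⊕ₜ var 2) (var 0 ⊕ₜ (var 1 ⊕ₜ var 2))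
                        (λ {A} → MVAlgebra.⊕-assoc A _ _ _) (assign x y z)
    ; ⊕-comm        = λ x y → mv-law (var 0 ⊕ₜ var 1) (var 1 ⊕ₜ var 0)
                        (λ {A} → MVAlgebra.⊕-comm A _ _) (assign x y y)
    ; ⊕-identityʳ   = λ x → mv-law (var 0 ⊕ₜ 𝟘ₜ) (var 0)
                        (λ {A} → MVAlgebra.⊕-identityʳ A _) (const x)
    ; ¬-involutive  = λ x → mv-law (¬ₜ (¬ₜ (var 0))) (var 0)
                        (λ {A} → MVAlgebra.¬-involutive A _) (const x)
    ; ⊕-absorb      = λ x → mv-law (var 0 ⊕ₜ ¬ₜ 𝟘ₜ) (¬ₜ 𝟘ₜ)
                        (λ {A} → MVAlgebra.⊕-absorb A _) (const x)
    ; łukasiewicz   = λ x y → mv-law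
                        (¬ₜ (¬ₜ (var 0) ⊕ₜ var 1) ⊕ₜ var 1) (¬ₜ (¬ₜ (var 1) ⊕ₜ var 0) ⊕ₜ var 0)
                        (λ {A} → MVAlgebra.łukasiewicz A _ _) (assign x y y)
    ; 𝟙-def         = mv-law 𝟙ₜ (¬ₜ 𝟘ₜ) (λ {A} → MVAlgebra.𝟙-def A) (const 𝟘)
    ; ⊙-def         = λ x y → mv-law (var 0 ⊙ₜ var 1) (¬ₜ (¬ₜ (var 0) ⊕ₜ ¬ₜ (var 1)))
                        (λ {A} → MVAlgebra.⊙-def A _ _) (assign x y y)
    }

  evalMV-ΔC : ∀ ρ t → evalMV ΔC t ρ ≡ evalI C (toITerm t) ρ
  evalMV-ΔC ρ (var n)  = refl
  evalMV-ΔC ρ 𝟘ₜ       = refl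
  evalMV-ΔC ρ 𝟙ₜ       = refl
  evalMV-ΔC ρ (¬ₜ t)   = cong (λ u → ¬ Δ u) (evalMV-ΔC ρ t)
  evalMV-ΔC ρ (s ⊕ₜ t) = cong₂ _⊕_ (evalMV-ΔC ρ s) (evalMV-ΔC ρ t)
  evalMV-ΔC ρ (s ⊙ₜ t) = cong₂ _⊙_ (evalMV-ΔC ρ s) (evalMV-ΔC ρ t)

  ΔC-holds⇒ : ∀ ρ {e} → holdsMV ΔC ρ e → holdsI C ρ (toIEquation e)
  ΔC-holds⇒ ρ {s ≐ t} = ≡.subst₂ (λ u v → Δ u ≈ Δ v) (evalMV-ΔC ρ s) (evalMV-ΔC ρ t)

  ΔC-holds⇐ : ∀ ρ {e} → holdsI C ρ (toIEquation e) → holdsMV ΔC ρ e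
  ΔC-holds⇐ ρ {s ≐ t} =
    ≡.subst₂ (λ u v → Δ u ≈ Δ v) (≡.sym (evalMV-ΔC ρ s)) (≡.sym (evalMV-ΔC ρ t))

  ΔC-⊨ : ∀ q → (∀ A → R A → A ⊨MV q) → ΔC ⊨MV q
  ΔC-⊨ q@(ps ⟹ e) valid ρ premises =
    ΔC-holds⇐ ρ {e}
      (C-⊨-toIQuasi q valid ρ (map⁺ (All.map (λ {e′} → ΔC-holds⇒ ρ {e′}) premises)))

  x≤∇x : ∀ x → MVAlgebra._≤_ ΔC x (∇ x)
  x≤∇x x = Δ-law (¬ₜ (Δₜ (var 0)) ⊕ₜ ∇ₜ (var 0)) 𝟙ₜ (λ {_} {ρ} → lo≤hi (ρ 0)) (const x)

  toInterval : IHom C (𝓘 ΔC)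
  toInterval = record
    { fun      = λ x → ⟦ x , ∇ x ⟧⟨ x≤∇x x ⟩
    ; fun-cong = λ x≈y → Δ-cong x≈y , Δ-cong (∇-cong x≈y)
    ; 𝟘-hom    = ≈-refl , Δ-law-≡ (∇ₜ 𝟘ₜ) 𝟘ₜ refl (const 𝟘)
    ; 𝟙-hom    = ≈-refl , Δ-law-≡ (∇ₜ 𝟙ₜ) 𝟙ₜ refl (const 𝟘)
    ; ι-hom    = Δ-law-≡ ιₜ 𝟘ₜ refl (const 𝟘) , Δ-law-≡ (∇ₜ ιₜ) 𝟙ₜ refl (const 𝟘)
    ; ¬-hom    = λ x → Δ-law-≡ (¬ₜ (var 0)) (¬ₜ (Δₜ (∇ₜ (var 0)))) refl (const x)
                     , Δ-law-≡ (∇ₜ (¬ₜ (var 0))) (¬ₜ (Δₜ (var 0))) refl (const x)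
    ; Δ-hom    = λ x → Δ-law-≡ (Δₜ (var 0)) (var 0) refl (const x)
                     , Δ-law-≡ (∇ₜ (Δₜ (var 0))) (var 0) refl (const x)
    ; ∇-hom    = λ x → ≈-refl , Δ-law-≡ (∇ₜ (∇ₜ (var 0))) (∇ₜ (var 0)) refl (const x)
    ; ⊕-hom    = λ x y → ≈-refl
                       , Δ-law-≡ (∇ₜ (var 0 ⊕ₜ var 1)) (∇ₜ (var 0) ⊕ₜ ∇ₜ (var 1)) refl
                                 (assign x y y)
    ; ⊙-hom    = λ x y → ≈-refl
                       , Δ-law-≡ (∇ₜ (var 0 ⊙ₜ var 1)) (∇ₜ (var 0) ⊙ₜ ∇ₜ (var 1)) refl
                                 (assign x y y)
    }

  fromEnds : Carrier → Carrier → Carrier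
  fromEnds a b = Δ a ⊕ ι ⊙ (Δ b ⊙ ¬ Δ a)

  fromEndsₜ : ITerm → ITerm → ITerm
  fromEndsₜ a b = Δₜ a ⊕ₜ (ιₜ ⊙ₜ (Δₜ b ⊙ₜ ¬ₜ (Δₜ a)))

  fromEnds-∇ : ∀ x → fromEnds x (∇ x) ≈ x
  fromEnds-∇ x = interval-law (fromEndsₜ (var 0) (∇ₜ (var 0))) (var 0)
    (λ {A} {ρ} → MVLemmas.x⊕𝟘⊙y≈x A _ _ , MVLemmas.x≤y⇒x⊕𝟙⊙[y⊙¬x]≈y A (lo≤hi (ρ 0)))
    (const x)

  Δ-fromEnds : ∀ a b → Δ (fromEnds a b) ≈ Δ a
  Δ-fromEnds a b = Δ-law (fromEndsₜ (var 0) (var 1)) (var 0)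
    (λ {A} → MVLemmas.x⊕𝟘⊙y≈x A _ _) (assign a b b)

  Δ∇-fromEnds : ∀ {a b} → MVAlgebra._≤_ ΔC a b → Δ (∇ (fromEnds a b)) ≈ Δ b
  Δ∇-fromEnds {a} {b} a≤b =
    C∈𝕀R ((a≤bₜ ∷ []) ⟹ (Δₜ (∇ₜ (fromEndsₜ (var 0) (var 1))) ≐ Δₜ (var 1)))
    (λ { A _ ρ ((lo₀≤lo₁ , _) ∷ []) →
           let hi≈lo₁ = MVLemmas.x≤y⇒x⊕𝟙⊙[y⊙¬x]≈y A lo₀≤lo₁ in hi≈lo₁ , hi≈lo₁ })
    (assign a b b) (a≤b ∷ [])
    where
      a≤bₜ : Equation ITerm
      a≤bₜ = Δₜ (¬ₜ (Δₜ (var 0)) ⊕ₜ var 1) ≐ Δₜ 𝟙ₜ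

  fromInterval : Interval ΔC → Carrier
  fromInterval u = fromEnds (lo u) (hi u)

  fromInterval-cong : ∀ {u v} → IAlgebra._≈_ (𝓘 ΔC) u v → fromInterval u ≈ fromInterval v
  fromInterval-cong (lo≈ , hi≈) = ⊕-cong lo≈ (⊙-cong ≈-refl (⊙-cong hi≈ (¬-cong lo≈)))

  C≅𝓘ΔC : IIso C (𝓘 ΔC)
  C≅𝓘ΔC = mkIIso toInterval fromInterval (λ {u} {v} → fromInterval-cong {u} {v}) fromEnds-∇
    (λ u → Δ-fromEnds (lo u) (hi u) , Δ∇-fromEnds (lo≤hi u))

corollary8p11 : ∀ {c ℓ : Level} (Σq : QuasiIdentity MVTerm → Set ℓ) →
    -- 𝓘 maps ℝ into 𝕀ℝ
    (∀ (A : MVAlgebra c) → ModMV Σq A → 𝕀 (ModMV Σq) (𝓘 A))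
    -- 𝓘 is faithful on ℝ
    × (∀ (A B : MVAlgebra c) → ModMV Σq A → ModMV Σq B → (h g : MVHom A B) →
         (∀ x → IAlgebra._≈_ (𝓘 B) (𝓘map h x) (𝓘map g x)) →
         ∀ a → MVAlgebra._≈_ B (MVHom.fun h a) (MVHom.fun g a))
    -- 𝓘 is full on ℝ
    × (∀ (A B : MVAlgebra c) → ModMV Σq A → ModMV Σq B → (f : IHom (𝓘 A) (𝓘 B)) →
         Σ (MVHom A B) λ h → ∀ x → IAlgebra._≈_ (𝓘 B) (IHom.fun f x) (𝓘map h x))
    -- 𝓘 is essentially surjective onto 𝕀ℝ
    × (∀ (C : IAlgebra c) → 𝕀 (ModMV Σq) C →
         Σ (MVAlgebra c) λ A → ModMV Σq A × IIso C (𝓘 A))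
corollary8p11 Σq =
    (λ _ A∈ℝ → 𝓘-∈-𝕀 A∈ℝ)
  , (λ _ _ _ _ → 𝓘map-injective)
  , (λ _ _ _ _ f → onPoints f , onPoints-extends f)
  , λ C C∈𝕀ℝ → let open ΔReduct C C∈𝕀ℝ in
      ΔC , (λ q q∈Σq → ΔC-⊨ q (λ A A∈ℝ → A∈ℝ q q∈Σq)) , C≅𝓘ΔC
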